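{- If $r\ge 10$ is an integer, then $\rho_2(3r-3,r)=3$.
   Context: For integers $n\ge 2r\ge 2$, the Kneser graph $K(n,r)$ has as vertices the $r$-element subsets of $[n]=\{1,\dots,n\}$, two vertices being adjacent iff they are disjoint. A 2-packing of a graph is a set of vertices that are pairwise at distance at least $3$ (no two adjacent and no two with a common neighbor); $\rho_2(G)$ is the maximum cardinality of a 2-packing, and $\rho_2(n,r)=\rho_2(K(n,r))$. -}

module Defs where

open import Data.Nat using (ℕ; _≤_)
open import Data.Fin.Subset using (Subset; ∣_∣; _∩_; Empty)
open import Data.List using (List; length)
open import Data.List.Relation.Unary.AllPairs using (AllPairs)
open import Data.List.Relation.Unary.All using (All)
open import Data.Product using (Σ; _×_; ∃)
open import Relation.Binary.PropositionalEquality using (_≡_)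
open import Relation.Nullary using (¬_)
open import Data.Empty using (⊥)

-- Vertices of the Kneser graph K(n,r): r-element subsets of [n] (n-bit vectors).
IsVertex : (n r : ℕ) → Subset n → Set
IsVertex n r s = ∣ s ∣ ≡ r

Adj : {n : ℕ} → Subset n → Subset n → Set
Adj s t = Empty (s ∩ t)

-- Two distinct vertices at distance ≥ 3 in K(n,r): they are not adjacent
-- and have no common neighbour (an r-subset disjoint from both).
Far : (n r : ℕ) → Subset n → Subset n → Set
Far n r s t = ¬ Adj s t × ((w : Subset n) → IsVertex n r w → Adj s w → Adj t w → ⊥)

Is2Packing : (n r : ℕ) → List (Subset n) → Set
Is2Packing n r xs =
  All (IsVertex n r) xs ×
  AllPairs (λ s t → ¬ (s ≡ t) × Far n r s t) xs

Rho2≡ : (n r k : ℕ) → Set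
Rho2≡ n r k =
  (Σ (List (Subset n)) λ xs → Is2Packing n r xs × length xs ≡ k) ×
  ((xs : List (Subset n)) → Is2Packing n r xs → length xs ≤ k)

{-# OPTIONS --safe #-}
-- Two r-subsets s, t of [n] are at distance ≥ 3 in K(n,r) iff they meet and fewer than
-- r points lie outside s ∪ t. Since |∁(s ∪ t)| = n − 2r + |s ∩ t|, for n = 3r − 3 this
-- says |s ∩ t| ∈ {1, 2}. Bonferroni's inequality for four vertices of a 2-packing then
-- gives 4r ≤ n + 6·2 = 3r + 9, impossible once r ≥ 10. Conversely, split [3r − 3] into
-- a head of three points and r − 2 blocks of three; for i = 0, 1, 2 the vertex
-- "head minus its i-th point, plus the i-th point of every block" has r elements, any
-- two of them share a head point, and their union misses exactly r − 2 points.
module Submission where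

open import Defs
open import Data.Bool using (not; _∨_)
open import Data.Fin using (Fin; zero; suc)
open import Data.Fin.Subset
  using (Subset; inside; outside; ∣_∣; _∩_; _∪_; ∁; ⋃; ⁅_⁆; _⊆_)
  renaming (⊥ to ∅)
open import Data.Fin.Subset.Properties
open import Data.List using (List; length; map; take; tabulate) renaming ([] to []ᴸ; _∷_ to _∷ᴸ_)
open import Data.List.Properties using (length-take)
open import Data.List.Relation.Unary.All as All using (All) renaming ([] to []ᴬ; _∷_ to _∷ᴬ_)
import Data.List.Relation.Unary.All.Properties as All
open import Data.List.Relation.Unary.AllPairs as AllPairs using (AllPairs)
  renaming ([] to []ᴬᴾ; _∷_ to _∷ᴬᴾ_)
import Data.List.Relation.Unary.AllPairs.Properties as AllPairs
open import Data.Nat using (ℕ; zero; suc; _+_; _*_; _∸_; _≤_; _<_; z≤n; s≤s)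
open import Data.Nat.Combinatorics using (_C_; nC1≡n; nCk+nC[k+1]≡[n+1]C[k+1])
open import Data.Nat.ListAction using (sum)
open import Data.Nat.Properties
open import Data.Product using (Σ; _×_; ∃; _,_)
open import Data.Sum using ([_,_])
open import Data.Vec using ([]; _∷_; _++_; concat; replicate; here; there)
open import Data.Vec.Properties using (map-++; zipWith-++)
open import Function using (_∘_)
open import Relation.Binary.PropositionalEquality
  using (_≡_; refl; sym; trans; cong; cong₂; subst; module ≡-Reasoning)
open import Relation.Nullary using (¬_)

private
  variable
    n r : ℕ
    s t w : Subset n

∣p∪q∣+∣p∩q∣≡∣p∣+∣q∣ : (p q : Subset n) → ∣ p ∪ q ∣ + ∣ p ∩ q ∣ ≡ ∣ p ∣ + ∣ q ∣
∣p∪q∣+∣p∩q∣≡∣p∣+∣q∣ []            []            = refl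
∣p∪q∣+∣p∩q∣≡∣p∣+∣q∣ (inside ∷ p)  (inside ∷ q)  = cong suc (begin
  ∣ p ∪ q ∣ + suc ∣ p ∩ q ∣ ≡⟨ +-suc _ _ ⟩
  suc (∣ p ∪ q ∣ + ∣ p ∩ q ∣) ≡⟨ cong suc (∣p∪q∣+∣p∩q∣≡∣p∣+∣q∣ p q) ⟩
  suc (∣ p ∣ + ∣ q ∣) ≡⟨ +-suc _ _ ⟨
  ∣ p ∣ + suc ∣ q ∣ ∎)
  where open ≡-Reasoning
∣p∪q∣+∣p∩q∣≡∣p∣+∣q∣ (inside ∷ p)  (outside ∷ q) = cong suc (∣p∪q∣+∣p∩q∣≡∣p∣+∣q∣ p q)
∣p∪q∣+∣p∩q∣≡∣p∣+∣q∣ (outside ∷ p) (inside ∷ q)  =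
  trans (cong suc (∣p∪q∣+∣p∩q∣≡∣p∣+∣q∣ p q)) (sym (+-suc _ _))
∣p∪q∣+∣p∩q∣≡∣p∣+∣q∣ (outside ∷ p) (outside ∷ q) = ∣p∪q∣+∣p∩q∣≡∣p∣+∣q∣ p q

∣p∪q∣≤∣p∣+∣q∣ : (p q : Subset n) → ∣ p ∪ q ∣ ≤ ∣ p ∣ + ∣ q ∣
∣p∪q∣≤∣p∣+∣q∣ p q = ≤-trans (m≤m+n _ _) (≤-reflexive (∣p∪q∣+∣p∩q∣≡∣p∣+∣q∣ p q))

∣∁p∣+∣p∣≡n : (p : Subset n) → ∣ ∁ p ∣ + ∣ p ∣ ≡ n
∣∁p∣+∣p∣≡n p = trans (cong (_+ ∣ p ∣) (∣∁p∣≡n∸∣p∣ p)) (m∸n+n≡m (∣p∣≤n p))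

∣∁[p∪q]∣+∣p∣+∣q∣≡n+∣p∩q∣ : (p q : Subset n) → ∣ ∁ (p ∪ q) ∣ + (∣ p ∣ + ∣ q ∣) ≡ n + ∣ p ∩ q ∣
∣∁[p∪q]∣+∣p∣+∣q∣≡n+∣p∩q∣ {n} p q = begin
  ∣ ∁ (p ∪ q) ∣ + (∣ p ∣ + ∣ q ∣)              ≡⟨ cong (∣ ∁ (p ∪ q) ∣ +_) (∣p∪q∣+∣p∩q∣≡∣p∣+∣q∣ p q) ⟨
  ∣ ∁ (p ∪ q) ∣ + (∣ p ∪ q ∣ + ∣ p ∩ q ∣)      ≡⟨ +-assoc (∣ ∁ (p ∪ q) ∣) (∣ p ∪ q ∣) (∣ p ∩ q ∣) ⟨
  ∣ ∁ (p ∪ q) ∣ + ∣ p ∪ q ∣ + ∣ p ∩ q ∣        ≡⟨ cong (_+ ∣ p ∩ q ∣) (∣∁p∣+∣p∣≡n (p ∪ q)) ⟩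
  n + ∣ p ∩ q ∣                                 ∎
  where open ≡-Reasoning

⊆-of-size : ∀ {k} (p : Subset n) → k ≤ ∣ p ∣ → ∃ λ w → w ⊆ p × ∣ w ∣ ≡ k
⊆-of-size {n} {k = zero}  p             _             = ∅ , ⊥⊆ , ∣⊥∣≡0 n
⊆-of-size     {k = suc k} (outside ∷ p) 1+k≤∣p∣       with ⊆-of-size p 1+k≤∣p∣
... | w , w⊆p , ∣w∣≡k+1 = outside ∷ w , out⊆ w⊆p , ∣w∣≡k+1
⊆-of-size     {k = suc k} (inside ∷ p)  (s≤s k≤∣p∣) with ⊆-of-size p k≤∣p∣
... | w , w⊆p , ∣w∣≡k = inside ∷ w , in⊆in w⊆p , cong suc ∣w∣≡k

disjoint-from-both⇒⊆∁∪ : Adj s w → Adj t w → w ⊆ ∁ (s ∪ t)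
disjoint-from-both⇒⊆∁∪ {s = s} {t = t} s∩w≡∅ t∩w≡∅ x∈w = x∉p⇒x∈∁p λ x∈s∪t →
  [ (λ x∈s → s∩w≡∅ (_ , x∈p∩q⁺ (x∈s , x∈w))) , (λ x∈t → t∩w≡∅ (_ , x∈p∩q⁺ (x∈t , x∈w))) ]
    (x∈p∪q⁻ s t x∈s∪t)

⊆∁⇒disjoint : w ⊆ ∁ s → Adj s w
⊆∁⇒disjoint {w = w} {s = s} w⊆∁s (x , x∈s∩w) with x∈p∩q⁻ s w x∈s∩w
... | x∈s , x∈w = x∈∁p⇒x∉p (w⊆∁s x∈w) x∈s

far⇒∣∁∪∣<r : Far n r s t → ∣ ∁ (s ∪ t) ∣ < r
far⇒∣∁∪∣<r {s = s} {t = t} (_ , noCommonNeighbour) = ≰⇒> λ r≤∣∁∪∣ →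
  let w , w⊆∁∪ , ∣w∣≡r = ⊆-of-size (∁ (s ∪ t)) r≤∣∁∪∣
  in noCommonNeighbour w ∣w∣≡r
       (⊆∁⇒disjoint (p⊆q⇒∁p⊇∁q (p⊆p∪q t) ∘ w⊆∁∪))
       (⊆∁⇒disjoint (p⊆q⇒∁p⊇∁q (q⊆p∪q s t) ∘ w⊆∁∪))

¬adj∧∣∁∪∣<r⇒far : ¬ Adj s t → ∣ ∁ (s ∪ t) ∣ < r → Far n r s t
¬adj∧∣∁∪∣<r⇒far ¬adj ∣∁∪∣<r = ¬adj , λ w ∣w∣≡r s∩w≡∅ t∩w≡∅ →
  <⇒≱ ∣∁∪∣<r (subst (_≤ _) ∣w∣≡r (p⊆q⇒∣p∣≤∣q∣ (disjoint-from-both⇒⊆∁∪ s∩w≡∅ t∩w≡∅)))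

far⇒n+∣∩∣<3r : IsVertex n r s → IsVertex n r t → Far n r s t → n + ∣ s ∩ t ∣ < 3 * r
far⇒n+∣∩∣<3r {n} {r} {s} {t} ∣s∣≡r ∣t∣≡r far = begin-strict
  n + ∣ s ∩ t ∣                    ≡⟨ ∣∁[p∪q]∣+∣p∣+∣q∣≡n+∣p∩q∣ s t ⟨
  ∣ ∁ (s ∪ t) ∣ + (∣ s ∣ + ∣ t ∣) ≡⟨ cong (∣ ∁ (s ∪ t) ∣ +_) (cong₂ _+_ ∣s∣≡r ∣t∣≡r) ⟩
  ∣ ∁ (s ∪ t) ∣ + (r + r)         <⟨ +-monoˡ-< (r + r) (far⇒∣∁∪∣<r far) ⟩
  r + (r + r)                      ≡⟨ cong (λ k → r + (r + k)) (+-identityʳ r) ⟨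
  3 * r                            ∎
  where open ≤-Reasoning

sum-map-≤ : ∀ {A : Set} {f : A → ℕ} {b} {xs : List A} →
            All (λ x → f x ≤ b) xs → sum (map f xs) ≤ length xs * b
sum-map-≤ []ᴬ = z≤n
sum-map-≤ (fx≤b ∷ᴬ fxs≤b) = +-mono-≤ fx≤b (sum-map-≤ fxs≤b)

sum-map-≡ : ∀ {A : Set} {f : A → ℕ} {b} {xs : List A} →
            All (λ x → f x ≡ b) xs → sum (map f xs) ≡ length xs * b
sum-map-≡ []ᴬ = refl
sum-map-≡ (fx≡b ∷ᴬ fxs≡b) = cong₂ _+_ fx≡b (sum-map-≡ fxs≡b)

overlaps : List (Subset n) → ℕ
overlaps []ᴸ        = 0
overlaps (p ∷ᴸ ps) = sum (map (λ q → ∣ p ∩ q ∣) ps) + overlaps ps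

∣p∩⋃qs∣≤Σ∣p∩q∣ : (p : Subset n) (qs : List (Subset n)) →
                 ∣ p ∩ ⋃ qs ∣ ≤ sum (map (λ q → ∣ p ∩ q ∣) qs)
∣p∩⋃qs∣≤Σ∣p∩q∣ {n} p []ᴸ = ≤-reflexive (trans (cong ∣_∣ (∩-zeroʳ p)) (∣⊥∣≡0 n))
∣p∩⋃qs∣≤Σ∣p∩q∣ p (q ∷ᴸ qs) = begin
  ∣ p ∩ (q ∪ ⋃ qs) ∣             ≡⟨ cong ∣_∣ (∩-distribˡ-∪ p q (⋃ qs)) ⟩
  ∣ p ∩ q ∪ p ∩ ⋃ qs ∣           ≤⟨ ∣p∪q∣≤∣p∣+∣q∣ (p ∩ q) (p ∩ ⋃ qs) ⟩
  ∣ p ∩ q ∣ + ∣ p ∩ ⋃ qs ∣       ≤⟨ +-monoʳ-≤ ∣ p ∩ q ∣ (∣p∩⋃qs∣≤Σ∣p∩q∣ p qs) ⟩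
  ∣ p ∩ q ∣ + sum (map (λ q → ∣ p ∩ q ∣) qs) ∎
  where open ≤-Reasoning

Σ∣p∣≤∣⋃ps∣+overlaps : (ps : List (Subset n)) → sum (map ∣_∣ ps) ≤ ∣ ⋃ ps ∣ + overlaps ps
Σ∣p∣≤∣⋃ps∣+overlaps []ᴸ = z≤n
Σ∣p∣≤∣⋃ps∣+overlaps (p ∷ᴸ ps) = begin
  ∣ p ∣ + sum (map ∣_∣ ps)                   ≤⟨ +-monoʳ-≤ ∣ p ∣ (Σ∣p∣≤∣⋃ps∣+overlaps ps) ⟩
  ∣ p ∣ + (∣ ⋃ ps ∣ + overlaps ps)           ≡⟨ +-assoc ∣ p ∣ ∣ ⋃ ps ∣ (overlaps ps) ⟨
  ∣ p ∣ + ∣ ⋃ ps ∣ + overlaps ps             ≡⟨ cong (_+ overlaps ps) (∣p∪q∣+∣p∩q∣≡∣p∣+∣q∣ p (⋃ ps)) ⟨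
  ∣ p ∪ ⋃ ps ∣ + ∣ p ∩ ⋃ ps ∣ + overlaps ps ≤⟨ +-monoˡ-≤ (overlaps ps)
                                                 (+-monoʳ-≤ ∣ p ∪ ⋃ ps ∣ (∣p∩⋃qs∣≤Σ∣p∩q∣ p ps)) ⟩
  ∣ p ∪ ⋃ ps ∣ + Σ∣p∩q∣ + overlaps ps        ≡⟨ +-assoc ∣ p ∪ ⋃ ps ∣ Σ∣p∩q∣ (overlaps ps) ⟩
  ∣ p ∪ ⋃ ps ∣ + (Σ∣p∩q∣ + overlaps ps)      ∎
  where
  open ≤-Reasoning
  Σ∣p∩q∣ = sum (map (λ q → ∣ p ∩ q ∣) ps)

overlaps≤C2*b : ∀ {b} {ps : List (Subset n)} →
                AllPairs (λ s t → ∣ s ∩ t ∣ ≤ b) ps → overlaps ps ≤ (length ps C 2) * b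
overlaps≤C2*b []ᴬᴾ = z≤n
overlaps≤C2*b {b = b} {ps = p ∷ᴸ ps} (heads ∷ᴬᴾ rest) = begin
  overlaps (p ∷ᴸ ps)                      ≤⟨ +-mono-≤ (sum-map-≤ heads) (overlaps≤C2*b rest) ⟩
  k * b + (k C 2) * b                     ≡⟨ *-distribʳ-+ b k (k C 2) ⟨
  (k + k C 2) * b                         ≡⟨ cong (λ j → (j + k C 2) * b) (nC1≡n k) ⟨
  (k C 1 + k C 2) * b                     ≡⟨ cong (_* b) (nCk+nC[k+1]≡[n+1]C[k+1] k 1) ⟩
  (suc k C 2) * b                         ∎
  where
  open ≤-Reasoning
  k = length ps

2packing⇒n+∣∩∣<3r : ∀ {xs} → Is2Packing n r xs → AllPairs (λ s t → n + ∣ s ∩ t ∣ < 3 * r) xs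
2packing⇒n+∣∩∣<3r ([]ᴬ , []ᴬᴾ) = []ᴬᴾ
2packing⇒n+∣∩∣<3r (∣s∣≡r ∷ᴬ vertices , fars ∷ᴬᴾ rest) =
  All.zipWith (λ (∣t∣≡r , _ , far) → far⇒n+∣∩∣<3r ∣s∣≡r ∣t∣≡r far) (vertices , fars)
    ∷ᴬᴾ 2packing⇒n+∣∩∣<3r (vertices , rest)

2packing-size-bound : ∀ {b xs} → 3 * r ≤ n + suc b → Is2Packing n r xs →
                      length xs * r ≤ n + (length xs C 2) * b
2packing-size-bound {r} {n} {b} {xs} 3r≤n+1+b packing@(vertices , _) = begin
  length xs * r             ≡⟨ sum-map-≡ vertices ⟨
  sum (map ∣_∣ xs)          ≤⟨ Σ∣p∣≤∣⋃ps∣+overlaps xs ⟩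
  ∣ ⋃ xs ∣ + overlaps xs    ≤⟨ +-mono-≤ (∣p∣≤n (⋃ xs))
                                 (overlaps≤C2*b (AllPairs.map overlap≤b (2packing⇒n+∣∩∣<3r packing))) ⟩
  n + (length xs C 2) * b   ∎
  where
  open ≤-Reasoning
  overlap≤b : ∀ {i} → n + i < 3 * r → i ≤ b
  overlap≤b n+i<3r = ≤-pred (+-cancelˡ-< n _ _ (<-≤-trans n+i<3r 3r≤n+1+b))

4r≤n+12⇒r≤9 : n + 3 ≡ 3 * r → 4 * r ≤ n + 12 → r ≤ 9
4r≤n+12⇒r≤9 {n} {r} n+3≡3r 4r≤n+12 = +-cancelʳ-≤ 3 r 9 (+-cancelˡ-≤ (3 * r) (r + 3) 12 (begin
  3 * r + (r + 3)   ≡⟨ +-assoc (3 * r) r 3 ⟨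
  3 * r + r + 3     ≡⟨ cong (_+ 3) (+-comm (3 * r) r) ⟩
  4 * r + 3         ≤⟨ +-monoˡ-≤ 3 4r≤n+12 ⟩
  n + 12 + 3        ≡⟨ trans (+-assoc n 12 3) (sym (+-assoc n 3 12)) ⟩
  n + 3 + 12        ≡⟨ cong (_+ 12) n+3≡3r ⟩
  3 * r + 12        ∎))
  where open ≤-Reasoning

2packing-size≤3 : n + 3 ≡ 3 * r → 10 ≤ r → ∀ {xs} → Is2Packing n r xs → length xs ≤ 3
2packing-size≤3 {n} {r} n+3≡3r 10≤r {xs} (vertices , pairs) =
  ≤-pred (≰⇒> λ 4≤∣xs∣ → <⇒≱ 10≤r (4r≤n+12⇒r≤9 n+3≡3r (first-four-bound 4≤∣xs∣)))
  where
  first-four-bound : 4 ≤ length xs → 4 * r ≤ n + 12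
  first-four-bound 4≤∣xs∣ =
    subst (λ k → k * r ≤ n + (k C 2) * 2) (trans (length-take 4 xs) (m≤n⇒m⊓n≡m 4≤∣xs∣))
      (2packing-size-bound (≤-reflexive (sym n+3≡3r))
        (All.take⁺ 4 vertices , AllPairs.take⁺ 4 pairs))

∣p++q∣≡∣p∣+∣q∣ : ∀ {m} (p : Subset m) (q : Subset n) → ∣ p ++ q ∣ ≡ ∣ p ∣ + ∣ q ∣
∣p++q∣≡∣p∣+∣q∣ []            q = refl
∣p++q∣≡∣p∣+∣q∣ (inside ∷ p)  q = cong suc (∣p++q∣≡∣p∣+∣q∣ p q)
∣p++q∣≡∣p∣+∣q∣ (outside ∷ p) q = ∣p++q∣≡∣p∣+∣q∣ p q

∣concat-replicate∣ : ∀ m (p : Subset n) → ∣ concat (replicate m p) ∣ ≡ m * ∣ p ∣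
∣concat-replicate∣ zero    p = refl
∣concat-replicate∣ (suc m) p =
  trans (∣p++q∣≡∣p∣+∣q∣ p _) (cong (∣ p ∣ +_) (∣concat-replicate∣ m p))

∪-concat-replicate : ∀ m (p q : Subset n) →
                     concat (replicate m p) ∪ concat (replicate m q) ≡ concat (replicate m (p ∪ q))
∪-concat-replicate zero    p q = refl
∪-concat-replicate (suc m) p q =
  trans (zipWith-++ _∨_ p _ q _) (cong (p ∪ q ++_) (∪-concat-replicate m p q))

∁-concat-replicate : ∀ m (p : Subset n) → ∁ (concat (replicate m p)) ≡ concat (replicate m (∁ p))
∁-concat-replicate zero    p = refl
∁-concat-replicate (suc m) p = trans (map-++ not p _) (cong (∁ p ++_) (∁-concat-replicate m p))

∣∁[concat-replicate∪concat-replicate]∣ : ∀ m (p q : Subset n) →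
  ∣ ∁ (concat (replicate m p) ∪ concat (replicate m q)) ∣ ≡ m * ∣ ∁ (p ∪ q) ∣
∣∁[concat-replicate∪concat-replicate]∣ m p q = begin
  ∣ ∁ (concat (replicate m p) ∪ concat (replicate m q)) ∣ ≡⟨ cong (∣_∣ ∘ ∁) (∪-concat-replicate m p q) ⟩
  ∣ ∁ (concat (replicate m (p ∪ q))) ∣                   ≡⟨ cong ∣_∣ (∁-concat-replicate m (p ∪ q)) ⟩
  ∣ concat (replicate m (∁ (p ∪ q))) ∣                   ≡⟨ ∣concat-replicate∣ m (∁ (p ∪ q)) ⟩
  m * ∣ ∁ (p ∪ q) ∣                                      ∎
  where open ≡-Reasoning

block : (m : ℕ) → Fin 3 → Subset (suc m * 3)
block m i = ∁ ⁅ i ⁆ ++ concat (replicate m ⁅ i ⁆)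

∣block∣ : ∀ m i → ∣ block m i ∣ ≡ 2 + m
∣block∣ m i = begin
  ∣ ∁ ⁅ i ⁆ ++ concat (replicate m ⁅ i ⁆) ∣ ≡⟨ ∣p++q∣≡∣p∣+∣q∣ (∁ ⁅ i ⁆) _ ⟩
  ∣ ∁ ⁅ i ⁆ ∣ + ∣ concat (replicate m ⁅ i ⁆) ∣ ≡⟨ cong₂ _+_ (∣∁p∣≡n∸∣p∣ ⁅ i ⁆) (∣concat-replicate∣ m ⁅ i ⁆) ⟩
  (3 ∸ ∣ ⁅ i ⁆ ∣) + m * ∣ ⁅ i ⁆ ∣ ≡⟨ cong (λ k → (3 ∸ k) + m * k) (∣⁅x⁆∣≡1 i) ⟩
  2 + m * 1 ≡⟨ cong (2 +_) (*-identityʳ m) ⟩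
  2 + m ∎
  where open ≡-Reasoning

blocks : (m : ℕ) → List (Subset (suc m * 3))
blocks m = tabulate (block m)

blocks-2packing : ∀ m → Is2Packing (suc m * 3) (2 + m) (blocks m)
blocks-2packing m =
  (∣block∣ m 0F ∷ᴬ ∣block∣ m 1F ∷ᴬ ∣block∣ m 2F ∷ᴬ []ᴬ) ,
  (((λ ()) , far (λ disjoint → disjoint (_ , there (there here))) (gap 0F 1F)) ∷ᴬ
   ((λ ()) , far (λ disjoint → disjoint (_ , there here)) (gap 0F 2F)) ∷ᴬ []ᴬ) ∷ᴬᴾ
  (((λ ()) , far (λ disjoint → disjoint (_ , here)) (gap 1F 2F)) ∷ᴬ []ᴬ) ∷ᴬᴾ
  []ᴬ ∷ᴬᴾ []ᴬᴾ
  where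
  0F 1F 2F : Fin 3
  0F = zero
  1F = suc zero
  2F = suc (suc zero)
  -- The heads of two distinct blocks cover Fin 3, so ∁ (block m i ∪ block m j)
  -- computes to the complement of the union of the tails.
  gap : ∀ i j → ∣ ∁ (concat (replicate m ⁅ i ⁆) ∪ concat (replicate m ⁅ j ⁆)) ∣ ≡ m * ∣ ∁ (⁅ i ⁆ ∪ ⁅ j ⁆) ∣
  gap i j = ∣∁[concat-replicate∪concat-replicate]∣ m ⁅ i ⁆ ⁅ j ⁆
  far : ∀ {s t} → ¬ Adj s t → ∣ ∁ (s ∪ t) ∣ ≡ m * 1 → Far (suc m * 3) (2 + m) s t
  far ¬adj ∣∁∪∣≡m = ¬adj∧∣∁∪∣<r⇒far ¬adj
    (subst (_< 2 + m) (sym (trans ∣∁∪∣≡m (*-identityʳ m))) (s≤s (n≤1+n m)))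

mainTheorem8 : (r : ℕ) → 10 ≤ r → Rho2≡ (3 * r ∸ 3) r 3
mainTheorem8 r@(suc (suc m)) 10≤r@(s≤s (s≤s _)) =
  subst (λ n → Σ (List (Subset n)) λ xs → Is2Packing n r xs × length xs ≡ 3)
    (cong (_∸ 3) (*-comm r 3)) (blocks m , blocks-2packing m , refl) ,
  λ _ → 2packing-size≤3 (m∸n+n≡m (*-monoʳ-≤ 3 {1} {r} (s≤s z≤n))) 10≤r
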